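{- Let $\Gamma$ be a distance-regular graph with diameter $D\ge4$ and valency $k$. Assume $a_1=0$ and there exists $i$ with $2\le i\le D-2$ such that $a_i\ne0$. Then (i) for every $\theta\in\mathbb{R}$ the pair $\theta,k$ is tight, and (ii) $\Gamma$ has no further tight pairs: if $\theta,\theta'\in\mathbb{R}$ form a tight pair then $\theta=k$ or $\theta'=k$.
   Context: $\Gamma$ is a finite, undirected, connected graph without loops or multiple edges, with path-length distance $\partial$ and diameter $D$. It is distance-regular: for all $0\le h,i,j\le D$ and all vertices $x,y$ with $\partial(x,y)=h$, the number $p^h_{ij}$ of vertices $z$ with $\partial(x,z)=i$, $\partial(y,z)=j$ depends only on $h,i,j$. Write $a_i=p^i_{1i}$, $b_i=p^i_{1,i+1}$ $(0\le i\le D-1)$, $c_i=p^i_{1,i-1}$ $(1\le i\le D)$, $c_0=0$, $b_D=0$, $k=b_0$. For $\theta\in\mathbb{R}$, the pseudo cosine sequence for $\theta$ is the sequence of reals $\sigma_0,\dots,\sigma_D$ with $\sigma_0=1$ and $c_i\sigma_{i-1}+a_i\sigma_i+b_i\sigma_{i+1}=\theta\sigma_i$ for $0\le i\le D-1$ (with $c_0\sigma_{ -1}=0$). Two pseudo cosine sequences $\sigma_i$, $\rho_i$ form a tight pair if $\sigma_0\rho_0,\dots,\sigma_D\rho_D$ is a pseudo cosine sequence; reals $\theta,\theta'$ form a tight pair if their pseudo cosine sequences do. -}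

module Defs where

open import Level using (0ℓ)
open import Data.Nat as ℕ using (ℕ; zero; suc)
open import Data.Bool using (Bool; true; false; _∧_; _∨_; not; T)
open import Data.Fin using (Fin)
open import Data.List using (List; length; filter; upTo)
open import Data.Bool.ListAction using (any)
open import Data.List using () renaming (allFin to allFinL)
open import Data.Product using (Σ; _×_; ∃; _,_)
open import Relation.Binary.PropositionalEquality using (_≡_)
open import Relation.Nullary using (¬_)
open import Relation.Unary using (Pred)
open import Algebra.Bundles using (CommutativeRing)
open import Data.Sum using (_⊎_)
open import Data.Bool using (T?; if_then_else_)
open import Relation.Nullary.Decidable using (⌊_⌋; does)
import Data.Fin as F

-- The real numbers, axiomatised as a complete ordered field.
-- (Any model is isomorphic to ℝ; the theorem is quantified over all models.)

record RealField : Set₁ where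
  field
    commRing : CommutativeRing 0ℓ 0ℓ
  open CommutativeRing commRing public
  field
    0≉1      : ¬ (0# ≈ 1#)
    inverse  : ∀ x → ¬ (x ≈ 0#) → Σ Carrier (λ y → x * y ≈ 1#)
    _≤_      : Carrier → Carrier → Set
    ≤-resp-≈ : ∀ {x x' y y'} → x ≈ x' → y ≈ y' → x ≤ y → x' ≤ y'
    ≤-refl   : ∀ {x} → x ≤ x
    ≤-trans  : ∀ {x y z} → x ≤ y → y ≤ z → x ≤ z
    ≤-antisym : ∀ {x y} → x ≤ y → y ≤ x → x ≈ y
    ≤-total  : ∀ x y → (x ≤ y) ⊎ (y ≤ x)
    +-mono-≤ : ∀ {x y} z → x ≤ y → (x + z) ≤ (y + z)
    *-nonneg : ∀ {x y} → 0# ≤ x → 0# ≤ y → 0# ≤ (x * y)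
    sup : (P : Pred Carrier 0ℓ) → Σ Carrier P → Σ Carrier (λ u → ∀ x → P x → x ≤ u) →
          Σ Carrier (λ s → (∀ x → P x → x ≤ s) × (∀ u → (∀ x → P x → x ≤ u) → s ≤ u))
  fromℕ : ℕ → Carrier
  fromℕ zero    = 0#
  fromℕ (suc n) = 1# + fromℕ n

record Graph : Set where
  field
    n      : ℕ
    adj    : Fin n → Fin n → Bool
    symm   : ∀ x y → adj x y ≡ adj y x
    irrefl : ∀ x → adj x x ≡ false

module _ (Γ : Graph) where
  open Graph Γ

  _==_ : Fin n → Fin n → Bool
  x == y = ⌊ x F.≟ y ⌋

  within : ℕ → Fin n → Fin n → Bool
  within zero    x y = x == y
  within (suc m) x y = within m x y ∨ any (λ z → adj x z ∧ within m z y) (allFinL n)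

  Connected : Set
  Connected = ∀ x y → T (within n x y)

  -- path-length distance: number of m < n such that y is not within m of x
  -- (for connected graphs this is the least m with a walk of length m).
  dist : Fin n → Fin n → ℕ
  dist x y = length (filter (λ m → T? (not (within m x y))) (upTo n))

  HasDiameter : ℕ → Set
  HasDiameter D = (∀ x y → dist x y ℕ.≤ D) × Σ (Fin n) (λ x → Σ (Fin n) (λ y → dist x y ≡ D))

  count : ℕ → ℕ → Fin n → Fin n → ℕ
  count i j x y = length (filter (λ z → T? ((dist x z ℕ.≡ᵇ i) ∧ (dist y z ℕ.≡ᵇ j))) (allFinL n))

  IsIntersectionArray : ℕ → (ℕ → ℕ → ℕ → ℕ) → Set
  IsIntersectionArray D p = ∀ x y i j → i ℕ.≤ D → j ℕ.≤ D → count i j x y ≡ p (dist x y) i j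

  DistanceRegular : ℕ → (ℕ → ℕ → ℕ → ℕ) → Set
  DistanceRegular D p = Connected × HasDiameter D × IsIntersectionArray D p

module Intersection (p : ℕ → ℕ → ℕ → ℕ) (D : ℕ) where
  a b c : ℕ → ℕ
  a i = p i 1 i
  b i = if i ℕ.≡ᵇ D then 0 else p i 1 (suc i)
  c zero    = 0
  c (suc i) = p (suc i) 1 i
  k : ℕ
  k = b 0

module Tight (ℝ : RealField) (p : ℕ → ℕ → ℕ → ℕ) (D : ℕ) where
  open RealField ℝ
  open Intersection p D

  -- σ : ℕ → ℝ, only the values σ 0 … σ D are relevant
  IsPseudoCosine : Carrier → (ℕ → Carrier) → Set
  IsPseudoCosine θ σ =
    (σ 0 ≈ 1#) ×
    (∀ i → i ℕ.< D →
       (cσ i + (fromℕ (a i) * σ i + fromℕ (b i) * σ (suc i))) ≈ (θ * σ i))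
    where
      cσ : ℕ → Carrier
      cσ zero    = 0#
      cσ (suc i) = fromℕ (c (suc i)) * σ i

  TightSeqs : (ℕ → Carrier) → (ℕ → Carrier) → Set
  TightSeqs σ ρ = Σ Carrier (λ η → IsPseudoCosine η (λ i → σ i * ρ i))

  TightPair : Carrier → Carrier → Set
  TightPair θ θ' = Σ (ℕ → Carrier) (λ σ → Σ (ℕ → Carrier) (λ ρ →
                     IsPseudoCosine θ σ × IsPseudoCosine θ' ρ × TightSeqs σ ρ))

-- Part (i): the constant sequence 1 is the pseudo cosine sequence of k (as cᵢ + aᵢ + bᵢ = k),
-- so every pseudo cosine sequence σ forms the tight pair (σ, 1) with it, and σ exists for each θ
-- because the bᵢ are nonzero.
--
-- Part (ii): let σ, ρ be the sequences of a tight pair θ, θ′. With a₀ = a₁ = 0 the recurrence at 1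
-- gives b₁σ₂ = kσ₁² − c₁ for σ, ρ and στ, whence k c₁ (σ₁² − 1)(ρ₁² − 1) = 0; by symmetry σ₁ = ±1.
-- If σ₁ = 1 then θ = kσ₁ = k. If σ₁ = −1 then θ = −k, and σ alternates in sign up to the first
-- index m + 1 with aₘ₊₁ ≠ 0, which exists and satisfies m + 3 ≤ D by hypothesis. There the
-- recurrences of ρ and στ give ρₘ₊₁ = ρₘ₊₂, which is nonzero since a pseudo cosine sequence has no
-- two consecutive zeros, and one step further they give θ′ = k.
--
-- The graph enters only through a₀ = 0, bᵢ > 0, cᵢ₊₁ > 0 and cᵢ + aᵢ + bᵢ = k; the reals only
-- through the field axioms and the absence of zero divisors, which follows from completeness.

module Submission where

open import Defs
open import Data.Bool using (Bool; true; false; T; not; _∧_; if_then_else_)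
open import Data.Bool.Properties using (T-∨; T-∧; T-≡)
open import Data.Empty using (⊥)
open import Data.Fin using (Fin)
open import Data.Integer as ℤ using (ℤ; +_; -[1+_]; _⊖_; sign; ∣_∣; _◃_)
import Data.Integer.Properties as ℤ
open import Data.List using (List; []; _∷_; _++_; [_]; length; filter; upTo)
  renaming (allFin to allFinL)
open import Data.List.Properties
  using (upTo-∷ʳ; filter-++; length-++; filter-some; filter-none; filter-all; length-filter; length-upTo)
open import Data.List.Membership.Propositional using (lose)
open import Data.List.Membership.Propositional.Properties using (∈-allFin)
open import Data.List.Relation.Unary.All using (All; universal)
open import Data.List.Relation.Unary.All.Properties using (applyUpTo⁺₁)
open import Data.List.Relation.Unary.Any using (satisfied)
open import Data.List.Relation.Unary.Any.Properties using (any⁺; any⁻)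
import Data.Maybe as Maybe
open import Data.Nat as ℕ using (ℕ; zero; suc)
import Data.Nat.Properties as ℕ
open import Data.Product using (Σ; ∃-syntax; _×_; _,_; proj₁; proj₂)
open import Data.Sign as Sign using (Sign)
open import Data.Sum as Sum using (_⊎_; inj₁; inj₂)
open import Data.Unit using (tt)
open import Function using (id; _∘_)
open import Function.Bundles using (Equivalence)
open import Relation.Nullary using (¬_; Dec; yes; no; contradiction)
open import Relation.Nullary.Decidable using (T?; toWitness; fromWitness; dec⇒maybe)
open import Relation.Unary using (Decidable)
open import Relation.Binary.PropositionalEquality as ≡ using (_≡_; _≢_)
open import Algebra.Solver.Ring.AlmostCommutativeRing
  using (fromCommutativeRing; _-Raw-AlmostCommutative⟶_)
import Algebra.Solver.Ring as RingSolver

least-witness : ∀ {P : ℕ → Set} → Decidable P → ∀ {n} → P n →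
                ∃[ m ] (m ℕ.≤ n × P m × (∀ {j} → j ℕ.< m → ¬ P j))
least-witness {P} P? {n} Pn with search (suc n)
  where
  search : ∀ N → (∀ {j} → j ℕ.< N → ¬ P j) ⊎ ∃[ m ] (m ℕ.< N × P m × (∀ {j} → j ℕ.< m → ¬ P j))
  search zero = inj₁ λ ()
  search (suc N) with search N
  ... | inj₂ (m , m<N , Pm , below) = inj₂ (m , ℕ.m<n⇒m<1+n m<N , Pm , below)
  ... | inj₁ none with P? N
  ...   | yes PN = inj₂ (N , ℕ.n<1+n N , PN , none)
  ...   | no ¬PN = inj₁ λ {j} j<1+N → Sum.[ none , (λ { ≡.refl → ¬PN }) ] (ℕ.m≤n⇒m<n∨m≡n (ℕ.≤-pred j<1+N))
... | inj₁ none                     = contradiction Pn (none (ℕ.n<1+n n))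
... | inj₂ (m , m<1+n , Pm , below) = m , ℕ.≤-pred m<1+n , Pm , below

module Counting where
  open import Data.Nat using (_+_; _≤_; _<_; z≤n; s≤s; _≡ᵇ_)
  open ≡ using (refl; sym; trans; cong; subst)
  open import Data.Nat.Properties using (≤-refl; ≤-trans; ≤-pred; n≤1+n; ≤-reflexive; ≤∧≢⇒<; <⇒≤; ≡⇒≡ᵇ; ≡ᵇ⇒≡)

  𝟙 : Bool → ℕ
  𝟙 b = if b then 1 else 0

  #[_]_ : ∀ {A : Set} → (A → Bool) → List A → ℕ
  #[ f ] xs = length (filter (λ x → T? (f x)) xs)

  #-∷ : ∀ {A : Set} (f : A → Bool) x xs → #[ f ] (x ∷ xs) ≡ 𝟙 (f x) + #[ f ] xs
  #-∷ f x xs with f x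
  ... | true  = refl
  ... | false = refl

  #-∷ʳ : ∀ {A : Set} (f : A → Bool) xs x → #[ f ] (xs ++ [ x ]) ≡ #[ f ] xs + 𝟙 (f x)
  #-∷ʳ f xs x = begin
    length (filter P? (xs ++ [ x ]))        ≡⟨ cong length (filter-++ P? xs [ x ]) ⟩
    length (filter P? xs ++ filter P? [ x ]) ≡⟨ length-++ (filter P? xs) ⟩
    #[ f ] xs + #[ f ] [ x ]               ≡⟨ cong (λ n → #[ f ] xs + n) (trans (#-∷ f x []) (ℕ.+-identityʳ _)) ⟩
    #[ f ] xs + 𝟙 (f x)                    ∎
    where
    open ≡.≡-Reasoning
    P? : ∀ x → Dec (T (f x))
    P? x = T? (f x)

  #-sum₃ : ∀ {A : Set} (f g h k : A → Bool) → (∀ x → 𝟙 (f x) ≡ 𝟙 (g x) + 𝟙 (h x) + 𝟙 (k x)) →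
           ∀ xs → #[ f ] xs ≡ #[ g ] xs + #[ h ] xs + #[ k ] xs
  #-sum₃ f g h k pointwise []       = refl
  #-sum₃ f g h k pointwise (x ∷ xs) = begin
    #[ f ] (x ∷ xs)                                          ≡⟨ #-∷ f x xs ⟩
    𝟙 (f x) + #[ f ] xs
      ≡⟨ cong₂ _+_ (pointwise x) (#-sum₃ f g h k pointwise xs) ⟩
    𝟙 (g x) + 𝟙 (h x) + 𝟙 (k x) + (#[ g ] xs + #[ h ] xs + #[ k ] xs)
      ≡⟨ interchange (𝟙 (g x)) (𝟙 (h x)) (𝟙 (k x)) (#[ g ] xs) (#[ h ] xs) (#[ k ] xs) ⟩
    (𝟙 (g x) + #[ g ] xs) + (𝟙 (h x) + #[ h ] xs) + (𝟙 (k x) + #[ k ] xs)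
      ≡⟨ cong₂ _+_ (cong₂ _+_ (sym (#-∷ g x xs)) (sym (#-∷ h x xs))) (sym (#-∷ k x xs)) ⟩
    #[ g ] (x ∷ xs) + #[ h ] (x ∷ xs) + #[ k ] (x ∷ xs)      ∎
    where
    open ≡.≡-Reasoning
    open ≡ using (cong₂)
    open import Data.Nat.Tactic.RingSolver using (solve-∀)
    interchange : ∀ a b c d e f → a + b + c + (d + e + f) ≡ (a + d) + (b + e) + (c + f)
    interchange = solve-∀

  ¬T⇒T-not : ∀ {b} → ¬ T b → T (not b)
  ¬T⇒T-not {true}  ¬t = ¬t tt
  ¬T⇒T-not {false} _  = tt

  -- For upward closed q, #not N counts the m < N with ¬ q m, i.e. it is the least m with q m
  -- (capped at N); dist is defined this way.
  module UpwardClosed (q : ℕ → Bool) (q-suc : ∀ {m} → T (q m) → T (q (suc m))) where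

    #not : ℕ → ℕ
    #not N = #[ (λ m → not (q m)) ] upTo N

    q-mono : ∀ {m m′} → m ≤ m′ → T (q m) → T (q m′)
    q-mono {m} m≤m′ qm = go (ℕ.≤⇒≤′ m≤m′)
      where
      go : ∀ {m′} → m ℕ.≤′ m′ → T (q m′)
      go ℕ.≤′-refl        = qm
      go (ℕ.≤′-step m≤′n) = q-suc (go m≤′n)

    #not-suc : ∀ N → #not (suc N) ≡ #not N + 𝟙 (not (q N))
    #not-suc N = trans (cong #[ _ ]_ (sym (upTo-∷ʳ N))) (#-∷ʳ _ (upTo N) N)

    #not≤ : ∀ N → #not N ≤ N
    #not≤ N = ≤-trans (length-filter _ (upTo N)) (≤-reflexive (length-upTo N))

    #not-mono : ∀ {N M} → N ≤ M → #not N ≤ #not M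
    #not-mono {N} N≤M = go (ℕ.≤⇒≤′ N≤M)
      where
      go : ∀ {M} → N ℕ.≤′ M → #not N ≤ #not M
      go ℕ.≤′-refl        = ≤-refl
      go (ℕ.≤′-step N≤′M) = ≤-trans (go N≤′M) (≤-trans (ℕ.m≤m+n _ _) (≤-reflexive (sym (#not-suc _))))

    q⇒#not≤ : ∀ {m} → T (q m) → ∀ N → #not N ≤ m
    q⇒#not≤ qm zero = z≤n
    q⇒#not≤ {m} qm (suc N) with m ℕ.≤? N
    ... | no  m≰N = ≤-trans (#not≤ (suc N)) (ℕ.≰⇒> m≰N)
    ... | yes m≤N = begin
      #not (suc N)             ≡⟨ #not-suc N ⟩
      #not N + 𝟙 (not (q N))   ≡⟨ cong (λ b → #not N + 𝟙 (not b)) (Equivalence.to T-≡ (q-mono m≤N qm)) ⟩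
      #not N + 0               ≡⟨ ℕ.+-identityʳ _ ⟩
      #not N                   ≤⟨ q⇒#not≤ qm N ⟩
      m                        ∎
      where open ℕ.≤-Reasoning

    ¬q⇒#not≡ : ∀ {m} → ¬ T (q m) → #not (suc m) ≡ suc m
    ¬q⇒#not≡ {m} ¬qm = trans (cong length (filter-all (λ i → T? (not (q i))) all-not)) (length-upTo (suc m))
      where
      all-not : All (λ i → T (not (q i))) (upTo (suc m))
      all-not = applyUpTo⁺₁ id (suc m) (λ i<1+m → ¬T⇒T-not (λ qi → ¬qm (q-mono (≤-pred i<1+m) qi)))

  𝟙-window : ∀ j d → j ≤ d → d ≤ 2 + j → 𝟙 (d ≡ᵇ j) + 𝟙 (d ≡ᵇ suc j) + 𝟙 (d ≡ᵇ 2 + j) ≡ 1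
  𝟙-window zero    zero    _ _ = refl
  𝟙-window zero    1       _ _ = refl
  𝟙-window zero    2       _ _ = refl
  𝟙-window zero    (suc (suc (suc d))) _ (s≤s (s≤s ()))
  𝟙-window (suc j) (suc d) (s≤s j≤d) (s≤s d≤2+j) = 𝟙-window j d j≤d d≤2+j

record IntersectionLaws (p : ℕ → ℕ → ℕ → ℕ) (D : ℕ) : Set where
  open Intersection p D
  field
    a₀≡0    : a 0 ≡ 0
    b>0     : ∀ {i} → i ℕ.< D → 0 ℕ.< b i
    c>0     : ∀ {i} → i ℕ.< D → 0 ℕ.< c (suc i)
    c+a+b≡k : ∀ {i} → i ℕ.< D → c i ℕ.+ a i ℕ.+ b i ≡ k

module GraphDistance (Γ : Graph) where
  open import Data.Nat using (_+_; _≤_; _<_; z≤n; s≤s; _≡ᵇ_)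
  open ≡ using (refl; sym; trans; cong; subst)
  open import Data.Nat.Properties using (≤-refl; ≤-trans; ≤-pred; n≤1+n; ≤-reflexive; ≤∧≢⇒<; <⇒≤; ≡⇒≡ᵇ; ≡ᵇ⇒≡)
  open Counting
  open Graph Γ

  Within : ℕ → Fin n → Fin n → Set
  Within m x y = T (within Γ m x y)

  Adj : Fin n → Fin n → Set
  Adj x y = T (adj x y)

  adj-sym : ∀ {x y} → Adj x y → Adj y x
  adj-sym {x} {y} = subst T (symm x y)

  within-refl : ∀ x → Within 0 x x
  within-refl x = fromWitness refl

  within-zero⁻ : ∀ {x y} → Within 0 x y → x ≡ y
  within-zero⁻ = toWitness

  within-suc : ∀ {m x y} → Within m x y → Within (suc m) x y
  within-suc {m} {x} {y} w = Equivalence.from (T-∨ {within Γ m x y}) (inj₁ w)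

  within-cons : ∀ {m x z y} → Adj x z → Within m z y → Within (suc m) x y
  within-cons {m} {x} {z} {y} a w =
    Equivalence.from T-∨ (inj₂ (any⁺ (λ v → adj x v ∧ within Γ m v y)
      (lose (∈-allFin z) (Equivalence.from T-∧ (a , w)))))

  within-suc⁻ : ∀ {m x y} → Within (suc m) x y → Within m x y ⊎ ∃[ z ] (Adj x z × Within m z y)
  within-suc⁻ {m} {x} {y} w with Equivalence.to (T-∨ {within Γ m x y}) w
  ... | inj₁ w′ = inj₁ w′
  ... | inj₂ w′ with satisfied (any⁻ (λ v → adj x v ∧ within Γ m v y) (allFinL n) w′)
  ...   | z , azw = inj₂ (z , Equivalence.to T-∧ azw)

  within-snoc : ∀ {m x y z} → Within m x y → Adj y z → Within (suc m) x z
  within-snoc {zero} {x} {y} w a with within-zero⁻ {x} {y} w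
  ... | refl = within-cons {0} a (within-refl _)
  within-snoc {suc m} {x} {y} {z} w a with within-suc⁻ {m} {x} {y} w
  ... | inj₁ w′           = within-suc {suc m} {x} {z} (within-snoc {m} w′ a)
  ... | inj₂ (v , av , w′) = within-cons {suc m} av (within-snoc {m} {v} w′ a)

  within-sym : ∀ {m x y} → Within m x y → Within m y x
  within-sym {zero} {x} {y} w with within-zero⁻ {x} {y} w
  ... | refl = w
  within-sym {suc m} {x} {y} w with within-suc⁻ {m} {x} {y} w
  ... | inj₁ w′           = within-suc {m} {y} {x} (within-sym {m} {x} {y} w′)
  ... | inj₂ (z , az , w′) = within-snoc {m} {y} {z} (within-sym {m} {z} {y} w′) (adj-sym az)

  module _ (x y : Fin n) where
    open UpwardClosed (λ m → within Γ m x y) (λ {m} → within-suc {m} {x} {y})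

    within⇒dist≤ : ∀ {m} → Within m x y → dist Γ x y ≤ m
    within⇒dist≤ w = q⇒#not≤ w n

    dist≤⇒within : Connected Γ → ∀ {m} → dist Γ x y ≤ m → Within m x y
    dist≤⇒within connected {m} d≤m with T? (within Γ m x y)
    ... | yes w  = w
    ... | no ¬w  = contradiction (≤-trans 1+m≤dist d≤m) ℕ.1+n≰n
      where
      m<n : m < n
      m<n = ℕ.≰⇒> (λ n≤m → ¬w (q-mono n≤m (connected x y)))
      1+m≤dist : suc m ≤ dist Γ x y
      1+m≤dist = ≤-trans (≤-reflexive (sym (¬q⇒#not≡ ¬w))) (#not-mono m<n)

  module Distance (connected : Connected Γ) where

    within-dist : ∀ x y → Within (dist Γ x y) x y
    within-dist x y = dist≤⇒within x y connected ≤-refl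

    dist-refl : ∀ x → dist Γ x x ≡ 0
    dist-refl x = ℕ.n≤0⇒n≡0 (within⇒dist≤ x x (within-refl x))

    dist-sym : ∀ x y → dist Γ x y ≡ dist Γ y x
    dist-sym x y = ℕ.≤-antisym (sym-≤ y x) (sym-≤ x y)
      where
      sym-≤ : ∀ x y → dist Γ y x ≤ dist Γ x y
      sym-≤ x y = within⇒dist≤ y x (within-sym {dist Γ x y} {x} {y} (within-dist x y))

    dist-adj≤ : ∀ {x z} y → Adj x z → dist Γ y z ≤ suc (dist Γ y x)
    dist-adj≤ {x} {z} y a = within⇒dist≤ y z (within-snoc {dist Γ y x} {y} {x} (within-dist y x) a)

    dist-descend : ∀ {u y d} → dist Γ u y ≡ suc d → ∃[ z ] (Adj u z × dist Γ z y ≡ d)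
    dist-descend {u} {y} {d} e with within-suc⁻ {d} {u} {y} (dist≤⇒within u y connected (≤-reflexive e))
    ... | inj₁ w = contradiction (≤-trans (≤-reflexive (sym e)) (within⇒dist≤ u y w)) ℕ.1+n≰n
    ... | inj₂ (z , a , w) = z , a , ℕ.≤-antisym (within⇒dist≤ z y w) (ℕ.≤-pred d<1+dist)
      where
      d<1+dist : suc d ≤ suc (dist Γ z y)
      d<1+dist = ≤-trans (≤-reflexive (sym e))
                   (within⇒dist≤ u y (within-cons {dist Γ z y} {u} {z} {y} a (within-dist z y)))

    adj⇒dist≡1 : ∀ {x z} → Adj x z → dist Γ x z ≡ 1
    adj⇒dist≡1 {x} {z} a = ℕ.≤-antisym (within⇒dist≤ x z (within-cons {0} a (within-refl z))) 1≤dist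
      where
      1≤dist : 1 ≤ dist Γ x z
      1≤dist = ℕ.≰⇒> λ dist≤0 → subst T (irrefl x)
        (subst (λ v → Adj x v) (sym (within-zero⁻ {x} {z} (dist≤⇒within x z connected dist≤0))) a)

    dist≡1⇒adj : ∀ {x z} → dist Γ x z ≡ 1 → Adj x z
    dist≡1⇒adj {x} {z} e with dist-descend {x} {z} {0} e
    ... | v , a , dist≡0 = subst (Adj x) (within-zero⁻ {v} {z} (dist≤⇒within v z connected (≤-reflexive dist≡0))) a

    geodesic-edge : ∀ {u y d j} → dist Γ u y ≡ d → j < d →
                    ∃[ v ] ∃[ w ] (Adj v w × dist Γ v y ≡ j × dist Γ w y ≡ suc j)
    geodesic-edge {d = zero} e ()
    geodesic-edge {u} {y} {suc d} {j} e j<1+d with dist-descend {u} {y} {d} e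
    ... | z , a , e′ with j ℕ.≟ d
    ...   | yes refl = z , u , adj-sym a , e′ , e
    ...   | no  j≢d  = geodesic-edge e′ (≤∧≢⇒< (≤-pred j<1+d) j≢d)

    neighbours-by-layer : ∀ {v y j} → dist Γ v y ≡ suc j →
      count Γ 1 1 v v ≡ count Γ 1 j v y + count Γ 1 (suc j) v y + count Γ 1 (2 + j) v y
    neighbours-by-layer {v} {y} {j} v∈layer = #-sum₃ _ _ _ _ layer (allFinL n)
      where
      layer : ∀ z → 𝟙 ((dist Γ v z ≡ᵇ 1) ∧ (dist Γ v z ≡ᵇ 1)) ≡
        𝟙 ((dist Γ v z ≡ᵇ 1) ∧ (dist Γ y z ≡ᵇ j)) + 𝟙 ((dist Γ v z ≡ᵇ 1) ∧ (dist Γ y z ≡ᵇ suc j))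
          + 𝟙 ((dist Γ v z ≡ᵇ 1) ∧ (dist Γ y z ≡ᵇ 2 + j))
      layer z with dist Γ v z ≡ᵇ 1 in adjacent
      ... | false = refl
      ... | true  = sym (𝟙-window j (dist Γ y z) lower upper)
        where
        vz : Adj v z
        vz = dist≡1⇒adj (≡ᵇ⇒≡ _ 1 (subst T (sym adjacent) tt))
        lower : j ≤ dist Γ y z
        lower = ≤-pred (≤-trans (≤-reflexive (trans (sym v∈layer) (dist-sym v y))) (dist-adj≤ y (adj-sym vz)))
        upper : dist Γ y z ≤ 2 + j
        upper = ≤-trans (dist-adj≤ y vz) (s≤s (≤-reflexive (trans (dist-sym y v) v∈layer)))

  distanceRegular⇒intersectionLaws : ∀ {D p} → DistanceRegular Γ D p → 0 < D → IntersectionLaws p D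
  distanceRegular⇒intersectionLaws {D} {p} (connected , (_ , x₀ , y₀ , dist≡D) , array) 0<D = record
    { a₀≡0    = a₀≡0
    ; b>0     = b>0
    ; c>0     = c>0
    ; c+a+b≡k = c+a+b≡k
    }
    where
    open Distance connected
    open Intersection p D

    count≡p : ∀ {x y h i j} → dist Γ x y ≡ h → i ≤ D → j ≤ D → count Γ i j x y ≡ p h i j
    count≡p {x} {y} {i = i} {j} refl i≤D j≤D = array x y i j i≤D j≤D

    count>0 : ∀ {x y i j} z → dist Γ x z ≡ i → dist Γ y z ≡ j → 0 < count Γ i j x y
    count>0 {x} {y} {i} {j} z ex ey = filter-some (λ z → T? ((dist Γ x z ≡ᵇ i) ∧ (dist Γ y z ≡ᵇ j)))
      (lose (∈-allFin z) (Equivalence.from T-∧ (≡⇒≡ᵇ _ _ ex , ≡⇒≡ᵇ _ _ ey)))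

    b≡p : ∀ {i} → i < D → b i ≡ p i 1 (suc i)
    b≡p {i} i<D with i ≡ᵇ D in eq
    ... | true  = contradiction (≡ᵇ⇒≡ i D (subst T (sym eq) tt)) (ℕ.<⇒≢ i<D)
    ... | false = refl

    1≤D : 1 ≤ D
    1≤D = 0<D

    a₀≡0 : a 0 ≡ 0
    a₀≡0 = trans (sym (count≡p (dist-refl x₀) 1≤D z≤n))
      (cong length (filter-none _ (universal (λ z → never (dist Γ x₀ z)) (allFinL n))))
      where
      never : ∀ e → ¬ T ((e ≡ᵇ 1) ∧ (e ≡ᵇ 0))
      never zero          ()
      never (suc zero)    ()
      never (suc (suc e)) ()

    b>0 : ∀ {i} → i < D → 0 < b i
    b>0 i<D with geodesic-edge dist≡D i<D
    ... | v , w , a , ev , ew = subst (0 <_) (trans (count≡p ev 1≤D i<D) (sym (b≡p i<D)))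
                                  (count>0 w (adj⇒dist≡1 a) (trans (dist-sym y₀ w) ew))

    c>0 : ∀ {i} → i < D → 0 < c (suc i)
    c>0 i<D with geodesic-edge dist≡D i<D
    ... | v , w , a , ev , ew = subst (0 <_) (count≡p ew 1≤D (<⇒≤ i<D))
                                  (count>0 v (adj⇒dist≡1 (adj-sym a)) (trans (dist-sym y₀ v) ev))

    c+a+b≡k : ∀ {i} → i < D → c i + a i + b i ≡ k
    c+a+b≡k {zero}  _   = cong (_+ b 0) a₀≡0
    c+a+b≡k {suc j} j<D with geodesic-edge dist≡D j<D
    ... | v , _ , _ , ev , _ = begin
      c (suc j) + a (suc j) + b (suc j)
        ≡⟨ cong₂ _+_ (cong₂ _+_ (sym (count≡p ev 1≤D (≤-trans (n≤1+n j) (<⇒≤ j<D))))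
                                (sym (count≡p ev 1≤D (<⇒≤ j<D))))
                     (trans (b≡p j<D) (sym (count≡p ev 1≤D j<D))) ⟩
      count Γ 1 j v y₀ + count Γ 1 (suc j) v y₀ + count Γ 1 (2 + j) v y₀
        ≡⟨ neighbours-by-layer ev ⟨
      count Γ 1 1 v v
        ≡⟨ count≡p (dist-refl v) 1≤D 1≤D ⟩
      p 0 1 1
        ≡⟨ b≡p 0<D ⟨
      k ∎
      where
      open ≡.≡-Reasoning
      open ≡ using (cong₂)

module RealFieldProperties (ℝ : RealField) where
  open RealField ℝ
  open import Algebra.Properties.AbelianGroup +-abelianGroup
    using (x∙y⁻¹≈ε⇒x≈y; x≈y⇒x∙y⁻¹≈ε; ⁻¹-involutive; ⁻¹-∙-comm; ε⁻¹≈ε)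
  open import Algebra.Properties.Ring ring using (-1*x≈-x)
  open import Relation.Binary.Reasoning.Setoid setoid
  open import Algebra.Properties.CommutativeSemigroup *-commutativeSemigroup using (interchange)

  fromℕ-+ : ∀ m n → fromℕ (m ℕ.+ n) ≈ fromℕ m + fromℕ n
  fromℕ-+ zero    n = sym (+-identityˡ (fromℕ n))
  fromℕ-+ (suc m) n = trans (+-congˡ (fromℕ-+ m n)) (sym (+-assoc 1# (fromℕ m) (fromℕ n)))

  fromℕ-* : ∀ m n → fromℕ (m ℕ.* n) ≈ fromℕ m * fromℕ n
  fromℕ-* zero    n = sym (zeroˡ (fromℕ n))
  fromℕ-* (suc m) n = begin
    fromℕ (n ℕ.+ m ℕ.* n)              ≈⟨ fromℕ-+ n (m ℕ.* n) ⟩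
    fromℕ n + fromℕ (m ℕ.* n)          ≈⟨ +-cong (sym (*-identityˡ (fromℕ n))) (fromℕ-* m n) ⟩
    1# * fromℕ n + fromℕ m * fromℕ n   ≈⟨ distribʳ (fromℕ n) 1# (fromℕ m) ⟨
    (1# + fromℕ m) * fromℕ n           ∎

  fromℤ : ℤ → Carrier
  fromℤ (+ n)    = fromℕ n
  fromℤ -[1+ n ] = - fromℕ (suc n)

  fromℤ-neg : ∀ i → fromℤ (ℤ.- i) ≈ - fromℤ i
  fromℤ-neg (+ zero)  = sym ε⁻¹≈ε
  fromℤ-neg (+ suc n) = refl
  fromℤ-neg -[1+ n ]  = sym (⁻¹-involutive (fromℕ (suc n)))

  1+x-[1+y]≈x-y : ∀ x y → (1# + x) - (1# + y) ≈ x - y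
  1+x-[1+y]≈x-y x y = begin
    (1# + x) + - (1# + y)     ≈⟨ +-cong (+-comm 1# x) (sym (⁻¹-∙-comm 1# y)) ⟩
    (x + 1#) + (- 1# + - y)   ≈⟨ +-assoc x 1# (- 1# + - y) ⟩
    x + (1# + (- 1# + - y))   ≈⟨ +-congˡ (+-assoc 1# (- 1#) (- y)) ⟨
    x + ((1# + - 1#) + - y)   ≈⟨ +-congˡ (+-congʳ (-‿inverseʳ 1#)) ⟩
    x + (0# + - y)            ≈⟨ +-congˡ (+-identityˡ (- y)) ⟩
    x - y                     ∎

  fromℤ-⊖ : ∀ m n → fromℤ (m ⊖ n) ≈ fromℕ m - fromℕ n
  fromℤ-⊖ zero    zero    = sym (-‿inverseʳ 0#)
  fromℤ-⊖ (suc m) zero    = sym (trans (+-congˡ ε⁻¹≈ε) (+-identityʳ _))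
  fromℤ-⊖ zero    (suc n) = sym (+-identityˡ _)
  fromℤ-⊖ (suc m) (suc n) = begin
    fromℤ (suc m ⊖ suc n)   ≡⟨ ≡.cong fromℤ (ℤ.[1+m]⊖[1+n]≡m⊖n m n) ⟩
    fromℤ (m ⊖ n)           ≈⟨ fromℤ-⊖ m n ⟩
    fromℕ m - fromℕ n       ≈⟨ 1+x-[1+y]≈x-y (fromℕ m) (fromℕ n) ⟨
    fromℕ (suc m) - fromℕ (suc n) ∎

  fromℤ-+ : ∀ i j → fromℤ (i ℤ.+ j) ≈ fromℤ i + fromℤ j
  fromℤ-+ (+ m)    (+ n)    = fromℕ-+ m n
  fromℤ-+ (+ m)    -[1+ n ] = fromℤ-⊖ m (suc n)
  fromℤ-+ -[1+ m ] (+ n)    = trans (fromℤ-⊖ n (suc m)) (+-comm _ _)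
  fromℤ-+ -[1+ m ] -[1+ n ] = begin
    - fromℕ (suc (suc (m ℕ.+ n)))        ≡⟨ ≡.cong (λ k → - fromℕ (suc k)) (ℕ.+-suc m n) ⟨
    - fromℕ (suc m ℕ.+ suc n)            ≈⟨ -‿cong (fromℕ-+ (suc m) (suc n)) ⟩
    - (fromℕ (suc m) + fromℕ (suc n))    ≈⟨ ⁻¹-∙-comm _ _ ⟨
    - fromℕ (suc m) + - fromℕ (suc n)    ∎

  fromSign : Sign → Carrier
  fromSign Sign.+ = 1#
  fromSign Sign.- = - 1#

  fromℤ-◃ : ∀ s n → fromℤ (s ◃ n) ≈ fromSign s * fromℕ n
  fromℤ-◃ s       zero    = sym (zeroʳ (fromSign s))
  fromℤ-◃ Sign.+  (suc n) = sym (*-identityˡ _)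
  fromℤ-◃ Sign.-  (suc n) = sym (-1*x≈-x _)

  fromSign-* : ∀ s t → fromSign (s Sign.* t) ≈ fromSign s * fromSign t
  fromSign-* Sign.+ t      = sym (*-identityˡ _)
  fromSign-* Sign.- Sign.+ = sym (*-identityʳ _)
  fromSign-* Sign.- Sign.- = sym (trans (-1*x≈-x (- 1#)) (⁻¹-involutive 1#))

  fromℤ-* : ∀ i j → fromℤ (i ℤ.* j) ≈ fromℤ i * fromℤ j
  fromℤ-* i j = begin
    fromℤ ((sign i Sign.* sign j) ◃ ∣ i ∣ ℕ.* ∣ j ∣)
      ≈⟨ fromℤ-◃ (sign i Sign.* sign j) (∣ i ∣ ℕ.* ∣ j ∣) ⟩
    fromSign (sign i Sign.* sign j) * fromℕ (∣ i ∣ ℕ.* ∣ j ∣)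
      ≈⟨ *-cong (fromSign-* (sign i) (sign j)) (fromℕ-* ∣ i ∣ ∣ j ∣) ⟩
    (fromSign (sign i) * fromSign (sign j)) * (fromℕ ∣ i ∣ * fromℕ ∣ j ∣)
      ≈⟨ interchange _ _ _ _ ⟩
    (fromSign (sign i) * fromℕ ∣ i ∣) * (fromSign (sign j) * fromℕ ∣ j ∣)
      ≈⟨ *-cong (signAbs i) (signAbs j) ⟨
    fromℤ i * fromℤ j ∎
    where
    signAbs : ∀ i → fromℤ i ≈ fromSign (sign i) * fromℕ ∣ i ∣
    signAbs i = trans (reflexive (≡.cong fromℤ (≡.sym (ℤ.◃-inverse i)))) (fromℤ-◃ (sign i) ∣ i ∣)

  -- The solver's integer constants; the clause for + 1 makes con (+ 1) denote 1# itself, so that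
  -- it matches hypotheses such as σ 0 ≈ 1# syntactically.
  coefficient : ℤ → Carrier
  coefficient (+ 1) = 1#
  coefficient i     = fromℤ i

  coefficient≈fromℤ : ∀ i → coefficient i ≈ fromℤ i
  coefficient≈fromℤ (+ zero)          = refl
  coefficient≈fromℤ (+ suc zero)      = sym (+-identityʳ 1#)
  coefficient≈fromℤ (+ suc (suc n))   = refl
  coefficient≈fromℤ -[1+ n ]          = refl

  coefficient-homomorphism : ℤ.+-*-rawRing -Raw-AlmostCommutative⟶ fromCommutativeRing commRing
  coefficient-homomorphism = record
    { ⟦_⟧    = coefficient
    ; +-homo = λ i j → via (i ℤ.+ j) (fromℤ-+ i j) (+-cong (coefficient≈fromℤ i) (coefficient≈fromℤ j))
    ; *-homo = λ i j → via (i ℤ.* j) (fromℤ-* i j) (*-cong (coefficient≈fromℤ i) (coefficient≈fromℤ j))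
    ; -‿homo = λ i → via (ℤ.- i) (fromℤ-neg i) (-‿cong (coefficient≈fromℤ i))
    ; 0-homo = refl
    ; 1-homo = refl
    }
    where
    via : ∀ i {x y} → fromℤ i ≈ x → y ≈ x → coefficient i ≈ y
    via i p q = trans (coefficient≈fromℤ i) (trans p (sym q))

  coefficient-≟ : ∀ i j → Maybe.Maybe (coefficient i ≈ coefficient j)
  coefficient-≟ i j = Maybe.map (λ { ≡.refl → refl }) (dec⇒maybe (i ℤ.≟ j))

  open RingSolver ℤ.+-*-rawRing (fromCommutativeRing commRing) coefficient-homomorphism coefficient-≟
    public using (solve; _:=_; _:+_; _:*_; :-_; _:-_; con)

  -- Proofs by linear combination: the solver checks x - y = Σ cᵢ (Lᵢ - Rᵢ) as a polynomial
  -- identity, and each hypothesis Lᵢ ≈ Rᵢ makes its summand vanish.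
  infixl 6 _⊞_
  infix 7 _·_

  x≈y⇒x-y≈0 : ∀ {x y} → x ≈ y → x - y ≈ 0#
  x≈y⇒x-y≈0 = x≈y⇒x∙y⁻¹≈ε

  _·_ : ∀ c {x y} → x ≈ y → c * (x - y) ≈ 0#
  c · x≈y = trans (*-congˡ (x≈y⇒x-y≈0 x≈y)) (zeroʳ c)

  _⊞_ : ∀ {x y} → x ≈ 0# → y ≈ 0# → x + y ≈ 0#
  x≈0 ⊞ y≈0 = trans (+-cong x≈0 y≈0) (+-identityʳ 0#)

  linear-combination : ∀ {x y z} → x - y ≈ z → z ≈ 0# → x ≈ y
  linear-combination x-y≈z z≈0 = x∙y⁻¹≈ε⇒x≈y _ _ (trans x-y≈z z≈0)

  x≤y⇒0≤y-x : ∀ {x y} → x ≤ y → 0# ≤ (y - x)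
  x≤y⇒0≤y-x {x} {y} x≤y = ≤-resp-≈ (-‿inverseʳ x) refl (+-mono-≤ (- x) x≤y)

  0≤y-x⇒x≤y : ∀ {x y} → 0# ≤ (y - x) → x ≤ y
  0≤y-x⇒x≤y {x} {y} 0≤y-x =
    ≤-resp-≈ (+-identityˡ x) (solve 2 (λ x y → (y :- x) :+ x := y) refl x y) (+-mono-≤ x 0≤y-x)

  0≤x*x : ∀ x → 0# ≤ (x * x)
  0≤x*x x with ≤-total 0# x
  ... | inj₁ 0≤x = *-nonneg 0≤x 0≤x
  ... | inj₂ x≤0 = ≤-resp-≈ refl (solve 1 (λ x → (con (+ 0) :- x) :* (con (+ 0) :- x) := x :* x) refl x)
                     (*-nonneg (x≤y⇒0≤y-x x≤0) (x≤y⇒0≤y-x x≤0))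

  0≤1 : 0# ≤ 1#
  0≤1 = ≤-resp-≈ refl (*-identityˡ 1#) (0≤x*x 1#)

  *-monoˡ-≤-nonneg : ∀ {x y z} → 0# ≤ z → x ≤ y → (z * x) ≤ (z * y)
  *-monoˡ-≤-nonneg {x} {y} {z} 0≤z x≤y = 0≤y-x⇒x≤y (≤-resp-≈ refl
    (solve 3 (λ x y z → z :* (y :- x) := z :* y :- z :* x) refl x y z) (*-nonneg 0≤z (x≤y⇒0≤y-x x≤y)))

  0≤fromℕ : ∀ n → 0# ≤ fromℕ n
  0≤fromℕ zero    = ≤-refl
  0≤fromℕ (suc n) = ≤-trans (≤-resp-≈ refl (sym (+-identityˡ (fromℕ n))) (0≤fromℕ n)) (+-mono-≤ (fromℕ n) 0≤1)

  1≤x⇒x≰0 : ∀ {x} → 1# ≤ x → ¬ (x ≤ 0#)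
  1≤x⇒x≰0 1≤x x≤0 = 0≉1 (≤-antisym 0≤1 (≤-trans 1≤x x≤0))

  fromℕ-suc≉0 : ∀ n → fromℕ (suc n) ≉ 0#
  fromℕ-suc≉0 n 1+n≈0 = 1≤x⇒x≰0 1≤1+n (≤-resp-≈ refl 1+n≈0 ≤-refl)
    where
    1≤1+n : 1# ≤ fromℕ (suc n)
    1≤1+n = ≤-resp-≈ (+-identityˡ 1#) (+-comm (fromℕ n) 1#) (+-mono-≤ 1# (0≤fromℕ n))

  n>0⇒fromℕ≉0 : ∀ {n} → 0 ℕ.< n → fromℕ n ≉ 0#
  n>0⇒fromℕ≉0 {suc n} _ = fromℕ-suc≉0 n
  -- The multiples n x of a nonnegative x with x * x ≈ 0 are bounded by 1; if s is their
  -- supremum, then s - x is an upper bound as well, so x ≤ 0.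
  nonneg-nilpotent⇒≤0 : ∀ {x} → 0# ≤ x → x * x ≈ 0# → x ≤ 0#
  nonneg-nilpotent⇒≤0 {x} 0≤x x²≈0 =
    0≤y-x⇒x≤y (≤-resp-≈ refl (solve 2 (λ s x → s :- x :- s := con (+ 0) :- x) refl s x)
                            (x≤y⇒0≤y-x (least (s - x) s-x-isUpperBound)))
    where
    Multiple : Carrier → Set
    Multiple t = Σ ℕ λ n → t ≈ fromℕ n * x

    multiple≤1 : ∀ t → Multiple t → t ≤ 1#
    multiple≤1 t (n , t≈nx) with ≤-total t 1#
    ... | inj₁ t≤1 = t≤1
    ... | inj₂ 1≤t = contradiction t≤0 (1≤x⇒x≰0 1≤t)
      where
      t*t≈0 : t * t ≈ 0#
      t*t≈0 = begin
        t * t                       ≈⟨ *-cong t≈nx t≈nx ⟩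
        (fromℕ n * x) * (fromℕ n * x)
          ≈⟨ solve 2 (λ n x → (n :* x) :* (n :* x) := (n :* n) :* (x :* x)) refl (fromℕ n) x ⟩
        (fromℕ n * fromℕ n) * (x * x) ≈⟨ *-congˡ x²≈0 ⟩
        (fromℕ n * fromℕ n) * 0#      ≈⟨ zeroʳ _ ⟩
        0#                          ∎
      t≤0 : t ≤ 0#
      t≤0 = ≤-resp-≈ (*-identityʳ t) t*t≈0
              (*-monoˡ-≤-nonneg (≤-trans 0≤1 1≤t) 1≤t)

    supremum : Σ Carrier λ s → (∀ t → Multiple t → t ≤ s) × (∀ u → (∀ t → Multiple t → t ≤ u) → s ≤ u)
    supremum = sup Multiple (0# , 0 , sym (zeroˡ x)) (1# , multiple≤1)
    s : Carrier
    s = proj₁ supremum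
    isUpperBound : ∀ t → Multiple t → t ≤ s
    isUpperBound = proj₁ (proj₂ supremum)
    least : ∀ u → (∀ t → Multiple t → t ≤ u) → s ≤ u
    least = proj₂ (proj₂ supremum)

    s-x-isUpperBound : ∀ t → Multiple t → t ≤ (s - x)
    s-x-isUpperBound t (n , t≈nx) = ≤-resp-≈
      (sym (trans t≈nx (sym (solve 2 (λ n x → (con (+ 1) :+ n) :* x :- x := n :* x) refl (fromℕ n) x))))
      refl (+-mono-≤ (- x) (isUpperBound _ (suc n , refl)))

  x*x≈0⇒x≈0 : ∀ {x} → x * x ≈ 0# → x ≈ 0#
  x*x≈0⇒x≈0 {x} x²≈0 with ≤-total 0# x
  ... | inj₁ 0≤x = ≤-antisym (nonneg-nilpotent⇒≤0 0≤x x²≈0) 0≤x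
  ... | inj₂ x≤0 = ≤-antisym x≤0 (≤-resp-≈ refl (solve 1 (λ x → con (+ 0) :- (con (+ 0) :- x) := x) refl x)
                     (x≤y⇒0≤y-x (nonneg-nilpotent⇒≤0 (x≤y⇒0≤y-x x≤0) -x²≈0)))
    where
    -x²≈0 : (0# - x) * (0# - x) ≈ 0#
    -x²≈0 = trans (solve 1 (λ x → (con (+ 0) :- x) :* (con (+ 0) :- x) := x :* x) refl x) x²≈0
  x*y≈0∧x²≤y²⇒x≈0 : ∀ {x y} → x * y ≈ 0# → (x * x) ≤ (y * y) → x ≈ 0#
  x*y≈0∧x²≤y²⇒x≈0 {x} {y} xy≈0 x²≤y² = x*x≈0⇒x≈0 (x*x≈0⇒x≈0 (≤-antisym x⁴≤0 (0≤x*x (x * x))))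
    where
    x²y²≈0 : (x * x) * (y * y) ≈ 0#
    x²y²≈0 = trans (solve 2 (λ x y → (x :* x) :* (y :* y) := (x :* y) :* (x :* y)) refl x y)
                   (trans (*-cong xy≈0 xy≈0) (zeroˡ 0#))
    x⁴≤0 : ((x * x) * (x * x)) ≤ 0#
    x⁴≤0 = ≤-resp-≈ refl x²y²≈0 (*-monoˡ-≤-nonneg (0≤x*x x) x²≤y²)

  x*y≈0⇒x≈0⊎y≈0 : ∀ {x y} → x * y ≈ 0# → x ≈ 0# ⊎ y ≈ 0#
  x*y≈0⇒x≈0⊎y≈0 {x} {y} xy≈0 with ≤-total (x * x) (y * y)
  ... | inj₁ x²≤y² = inj₁ (x*y≈0∧x²≤y²⇒x≈0 xy≈0 x²≤y²)
  ... | inj₂ y²≤x² = inj₂ (x*y≈0∧x²≤y²⇒x≈0 (trans (*-comm y x) xy≈0) y²≤x²)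

  *-cancelˡ : ∀ {x y z} → x ≉ 0# → x * y ≈ x * z → y ≈ z
  *-cancelˡ {x} {y} {z} x≉0 xy≈xz with inverse x x≉0
  ... | x⁻¹ , xx⁻¹≈1 = linear-combination
    (solve 4 (λ x x⁻¹ y z → y :- z := (:- (y :- z)) :* (x :* x⁻¹ :- con (+ 1)) :+ x⁻¹ :* (x :* y :- x :* z))
       refl x x⁻¹ y z)
    (_ · xx⁻¹≈1 ⊞ _ · xy≈xz)

  x-y≈0⇒x≈y : ∀ {x y} → x - y ≈ 0# → x ≈ y
  x-y≈0⇒x≈y = x∙y⁻¹≈ε⇒x≈y _ _

  x≉0∧x*y≈0⇒y≈0 : ∀ {x y} → x ≉ 0# → x * y ≈ 0# → y ≈ 0#
  x≉0∧x*y≈0⇒y≈0 {x} x≉0 xy≈0 = *-cancelˡ x≉0 (trans xy≈0 (sym (zeroʳ x)))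

  *-≉0 : ∀ {x y} → x ≉ 0# → y ≉ 0# → x * y ≉ 0#
  *-≉0 x≉0 y≉0 xy≈0 = y≉0 (x≉0∧x*y≈0⇒y≈0 x≉0 xy≈0)

  x*x≈1⇒x≈±1 : ∀ {x} → x * x ≈ 1# → x ≈ 1# ⊎ x ≈ - 1#
  x*x≈1⇒x≈±1 {x} x²≈1 with x*y≈0⇒x≈0⊎y≈0 {x - 1#} {x + 1#} factored
    where
    factored : (x - 1#) * (x + 1#) ≈ 0#
    factored = trans
      (solve 1 (λ x → (x :- con (+ 1)) :* (x :+ con (+ 1)) := con (+ 1) :* (x :* x :- con (+ 1))) refl x)
                     (1# · x²≈1)
  ... | inj₁ x-1≈0 = inj₁ (x∙y⁻¹≈ε⇒x≈y x 1# x-1≈0)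
  ... | inj₂ x+1≈0 = inj₂ (x∙y⁻¹≈ε⇒x≈y x (- 1#) (trans (+-congˡ (⁻¹-involutive 1#)) x+1≈0))

module PseudoCosines (ℝ : RealField) {p : ℕ → ℕ → ℕ → ℕ} {D : ℕ} (laws : IntersectionLaws p D) where
  open RealField ℝ
  open RealFieldProperties ℝ
  open Intersection p D
  open IntersectionLaws laws
  open Tight ℝ p D
  open import Relation.Binary.Reasoning.Setoid setoid

  C A B : ℕ → Carrier
  C i = fromℕ (c i)
  A i = fromℕ (a i)
  B i = fromℕ (b i)

  K : Carrier
  K = fromℕ k

  A≈0 : ∀ {i} → a i ≡ 0 → A i ≈ 0#
  A≈0 aᵢ≡0 = reflexive (≡.cong fromℕ aᵢ≡0)

  K≈C+A+B : ∀ {i} → i ℕ.< D → K ≈ C i + A i + B i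
  K≈C+A+B {i} i<D = begin
    fromℕ k                          ≡⟨ ≡.cong fromℕ (c+a+b≡k i<D) ⟨
    fromℕ (c i ℕ.+ a i ℕ.+ b i)      ≈⟨ fromℕ-+ (c i ℕ.+ a i) (b i) ⟩
    fromℕ (c i ℕ.+ a i) + B i        ≈⟨ +-congʳ (fromℕ-+ (c i) (a i)) ⟩
    C i + A i + B i                  ∎

  B≉0 : ∀ {i} → i ℕ.< D → B i ≉ 0#
  B≉0 i<D = n>0⇒fromℕ≉0 (b>0 i<D)

  C≉0 : ∀ {i} → i ℕ.< D → C (suc i) ≉ 0#
  C≉0 i<D = n>0⇒fromℕ≉0 (c>0 i<D)

  recurrence : ∀ {θ σ} → IsPseudoCosine θ σ → ∀ {i} → suc i ℕ.< D →
    C (suc i) * σ i + (A (suc i) * σ (suc i) + B (suc i) * σ (2 ℕ.+ i)) ≈ θ * σ (suc i)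
  recurrence (_ , rec) = rec (suc _)

  Kσ₁≈θ : ∀ {θ σ} → 0 ℕ.< D → IsPseudoCosine θ σ → K * σ 1 ≈ θ
  Kσ₁≈θ {θ} {σ} 0<D (σ₀≈1 , rec) = linear-combination
    (solve 5 (λ a k s₀ s₁ θ → k :* s₁ :- θ :=
        con (+ 1) :* (con (+ 0) :+ (a :* s₀ :+ k :* s₁) :- θ :* s₀) :+ (:- s₀) :* (a :- con (+ 0))
        :+ θ :* (s₀ :- con (+ 1)))
      refl (A 0) K (σ 0) (σ 1) θ)
    (1# · rec 0 0<D ⊞ _ · A≈0 a₀≡0 ⊞ _ · σ₀≈1)

  isPseudoCosine-resp : ∀ {θ σ σ′} → (∀ i → σ i ≈ σ′ i) → IsPseudoCosine θ σ → IsPseudoCosine θ σ′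
  isPseudoCosine-resp {θ} σ≈σ′ (σ₀≈1 , rec) = trans (sym (σ≈σ′ 0)) σ₀≈1 , λ
    { zero    i<D → trans (sym (+-congˡ (+-cong (*-congˡ (σ≈σ′ 0)) (*-congˡ (σ≈σ′ 1)))))
                          (trans (rec 0 i<D) (*-congˡ (σ≈σ′ 0)))
    ; (suc i) i<D → trans (sym (+-cong (*-congˡ (σ≈σ′ i))
                                       (+-cong (*-congˡ (σ≈σ′ (suc i))) (*-congˡ (σ≈σ′ (2 ℕ.+ i))))))
                          (trans (rec (suc i) i<D) (*-congˡ (σ≈σ′ (suc i))))
    }

  tightPair-sym : ∀ {θ θ′} → TightPair θ θ′ → TightPair θ′ θ
  tightPair-sym (σ , ρ , σ-cos , ρ-cos , η , στ-cos) =
    ρ , σ , ρ-cos , σ-cos , η , isPseudoCosine-resp (λ i → *-comm (σ i) (ρ i)) στ-cos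

  -- The value 0# for i ≥ D is never used.
  B⁻¹ : ℕ → Carrier
  B⁻¹ i with i ℕ.<? D
  ... | yes i<D = proj₁ (inverse (B i) (B≉0 i<D))
  ... | no  _   = 0#

  B*B⁻¹≈1 : ∀ {i} → i ℕ.< D → B i * B⁻¹ i ≈ 1#
  B*B⁻¹≈1 {i} i<D with i ℕ.<? D
  ... | yes i<D′ = proj₂ (inverse (B i) (B≉0 i<D′))
  ... | no  i≮D  = contradiction i<D i≮D

  -- (σ i , σ (i + 1)), solving the recurrence at i + 1 for σ (i + 2).
  pseudoCosine-pair : Carrier → ℕ → Carrier × Carrier
  pseudoCosine-pair θ zero    = 1# , B⁻¹ 0 * θ
  pseudoCosine-pair θ (suc i) = proj₂ σσ′ ,
    B⁻¹ (suc i) * (θ * proj₂ σσ′ - (C (suc i) * proj₁ σσ′ + A (suc i) * proj₂ σσ′))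
    where
    σσ′ : Carrier × Carrier
    σσ′ = pseudoCosine-pair θ i

  pseudoCosine : Carrier → ℕ → Carrier
  pseudoCosine θ i = proj₁ (pseudoCosine-pair θ i)

  pseudoCosine-isPseudoCosine : ∀ θ → IsPseudoCosine θ (pseudoCosine θ)
  pseudoCosine-isPseudoCosine θ = refl , λ
    { zero    0<D → linear-combination
        (solve 4 (λ a b b⁻¹ θ → con (+ 0) :+ (a :* con (+ 1) :+ b :* (b⁻¹ :* θ)) :- θ :* con (+ 1) :=
             con (+ 1) :* (a :- con (+ 0)) :+ θ :* (b :* b⁻¹ :- con (+ 1)))
          refl (A 0) (B 0) (B⁻¹ 0) θ)
        (1# · A≈0 a₀≡0 ⊞ θ · B*B⁻¹≈1 0<D)
    ; (suc i) i+1<D → linear-combination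
        (solve 7 (λ c a b b⁻¹ θ u v → c :* u :+ (a :* v :+ b :* (b⁻¹ :* (θ :* v :- (c :* u :+ a :* v)))) :- θ :* v :=
             (θ :* v :- (c :* u :+ a :* v)) :* (b :* b⁻¹ :- con (+ 1)))
          refl (C (suc i)) (A (suc i)) (B (suc i)) (B⁻¹ (suc i)) θ (pseudoCosine θ i) (pseudoCosine θ (suc i)))
        (_ · B*B⁻¹≈1 i+1<D)
    }

  one-isPseudoCosine : IsPseudoCosine K (λ _ → 1#)
  one-isPseudoCosine = refl , λ
    { zero    _ → linear-combination
        (solve 2 (λ a k → con (+ 0) :+ (a :* con (+ 1) :+ k :* con (+ 1)) :- k :* con (+ 1) :=
             con (+ 1) :* (a :- con (+ 0)))
          refl (A 0) K)
        (1# · A≈0 a₀≡0)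
    ; (suc i) i+1<D → linear-combination
        (solve 4 (λ c a b k → c :* con (+ 1) :+ (a :* con (+ 1) :+ b :* con (+ 1)) :- k :* con (+ 1) :=
             (:- con (+ 1)) :* (k :- (c :+ a :+ b)))
          refl (C (suc i)) (A (suc i)) (B (suc i)) K)
        (_ · K≈C+A+B i+1<D)
    }

  tightPair-K : ∀ θ → TightPair θ K
  tightPair-K θ = pseudoCosine θ , (λ _ → 1#) , pseudoCosine-isPseudoCosine θ , one-isPseudoCosine ,
                  θ , isPseudoCosine-resp (λ i → sym (*-identityʳ _)) (pseudoCosine-isPseudoCosine θ)

  Bσ₂≈Kσ₁²-C₁ : ∀ {θ σ} → a 1 ≡ 0 → 1 ℕ.< D → IsPseudoCosine θ σ → B 1 * σ 2 ≈ K * (σ 1 * σ 1) - C 1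
  Bσ₂≈Kσ₁²-C₁ {θ} {σ} a₁≡0 1<D σ-cos@(σ₀≈1 , _) = linear-combination
    (solve 8 (λ c a b k s₀ s₁ s₂ θ → b :* s₂ :- (k :* (s₁ :* s₁) :- c) :=
        con (+ 1) :* (c :* s₀ :+ (a :* s₁ :+ b :* s₂) :- θ :* s₁) :+ (:- c) :* (s₀ :- con (+ 1))
        :+ (:- s₁) :* (a :- con (+ 0)) :+ (:- s₁) :* (k :* s₁ :- θ))
      refl (C 1) (A 1) (B 1) K (σ 0) (σ 1) (σ 2) θ)
    (1# · recurrence σ-cos {0} 1<D ⊞ _ · σ₀≈1 ⊞ _ · A≈0 a₁≡0 ⊞ _ · Kσ₁≈θ (ℕ.<-trans ℕ.z<s 1<D) σ-cos)

  -- Multiply the equations B₁σ₂ ≈ Kσ₁² − C₁ for σ and ρ and compare with the one for στ.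
  KC·product≈0 : ∀ {θ θ′ σ ρ} → a 1 ≡ 0 → 1 ℕ.< D →
    IsPseudoCosine θ σ → IsPseudoCosine θ′ ρ → TightSeqs σ ρ → K * C 1 * ((σ 1 * σ 1 - 1#) * (ρ 1 * ρ 1 - 1#)) ≈ 0#
  KC·product≈0 {σ = σ} {ρ} a₁≡0 1<D σ-cos ρ-cos (η , τ-cos) = linear-combination
      (solve 8 (λ c a b k s r X Y →
          let bX = k :* (s :* s) :- c
              bZ = k :* (s :* s) :* (r :* r) :- c
          in k :* c :* ((s :* s :- con (+ 1)) :* (r :* r :- con (+ 1))) :- con (+ 0) :=
          (:- (b :* Y)) :* (b :* X :- bX)
          :+ (:- bX) :* (b :* Y :- (k :* (r :* r) :- c))
          :+ b :* (b :* (X :* Y) :- (k :* ((s :* r) :* (s :* r)) :- c))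
          :+ (:- bZ) :* (k :- (c :+ a :+ b))
          :+ (:- bZ) :* (a :- con (+ 0)))
        refl (C 1) (A 1) (B 1) K (σ 1) (ρ 1) (σ 2) (ρ 2))
      (_ · Bσ₂≈Kσ₁²-C₁ a₁≡0 1<D σ-cos ⊞ _ · Bσ₂≈Kσ₁²-C₁ a₁≡0 1<D ρ-cos ⊞ _ · Bσ₂≈Kσ₁²-C₁ a₁≡0 1<D τ-cos
       ⊞ _ · K≈C+A+B 1<D ⊞ _ · A≈0 a₁≡0)

  tight⇒σ₁²≈1⊎ρ₁²≈1 : ∀ {θ θ′ σ ρ} → a 1 ≡ 0 → 1 ℕ.< D →
    IsPseudoCosine θ σ → IsPseudoCosine θ′ ρ → TightSeqs σ ρ → σ 1 * σ 1 ≈ 1# ⊎ ρ 1 * ρ 1 ≈ 1#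
  tight⇒σ₁²≈1⊎ρ₁²≈1 a₁≡0 1<D σ-cos ρ-cos στ-cos =
    Sum.map x-y≈0⇒x≈y x-y≈0⇒x≈y (x*y≈0⇒x≈0⊎y≈0 (x≉0∧x*y≈0⇒y≈0 (*-≉0 (B≉0 0<D) (C≉0 0<D))
      (KC·product≈0 a₁≡0 1<D σ-cos ρ-cos στ-cos)))
    where
    0<D : 0 ℕ.< D
    0<D = ℕ.<-trans ℕ.z<s 1<D

  Cσ≈0 : ∀ {θ σ i} → IsPseudoCosine θ σ → suc i ℕ.< D → σ (suc i) ≈ 0# → σ (2 ℕ.+ i) ≈ 0# → C (suc i) * σ i ≈ 0#
  Cσ≈0 {θ} {σ} {i} σ-cos i+1<D σᵢ₊₁≈0 σᵢ₊₂≈0 = linear-combination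
    (solve 7 (λ c a b θ x y z → c :* x :- con (+ 0) :=
        con (+ 1) :* (c :* x :+ (a :* y :+ b :* z) :- θ :* y) :+ (θ :- a) :* (y :- con (+ 0))
        :+ (:- b) :* (z :- con (+ 0)))
      refl (C (suc i)) (A (suc i)) (B (suc i)) θ (σ i) (σ (suc i)) (σ (2 ℕ.+ i)))
    (1# · recurrence σ-cos i+1<D ⊞ _ · σᵢ₊₁≈0 ⊞ _ · σᵢ₊₂≈0)

  no-consecutive-zeros : ∀ {θ σ i} → IsPseudoCosine θ σ → i ℕ.< D → σ i ≈ 0# → σ (suc i) ≈ 0# → ⊥
  no-consecutive-zeros {i = zero} (σ₀≈1 , _) _ σ₀≈0 _ = 0≉1 (trans (sym σ₀≈0) σ₀≈1)
  no-consecutive-zeros {i = suc i} σ-cos i+1<D σᵢ₊₁≈0 σᵢ₊₂≈0 =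
    no-consecutive-zeros σ-cos i<D (x≉0∧x*y≈0⇒y≈0 (C≉0 i<D) (Cσ≈0 σ-cos i+1<D σᵢ₊₁≈0 σᵢ₊₂≈0)) σᵢ₊₁≈0
    where
    i<D : i ℕ.< D
    i<D = ℕ.<-trans (ℕ.n<1+n i) i+1<D

  module Alternating {m : ℕ} (a≡0 : ∀ {j} → j ℕ.≤ m → a j ≡ 0) (aₘ₊₁>0 : 0 ℕ.< a (suc m))
    (m+2<D : 2 ℕ.+ m ℕ.< D) {θ θ′ η σ ρ} (σ-cos : IsPseudoCosine θ σ) (ρ-cos : IsPseudoCosine θ′ ρ)
    (τ-cos : IsPseudoCosine η (λ i → σ i * ρ i)) (σ₁≈-1 : σ 1 ≈ - 1#) where

    m+1<D : suc m ℕ.< D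
    m+1<D = ℕ.<-trans (ℕ.n<1+n (suc m)) m+2<D

    m<D : m ℕ.< D
    m<D = ℕ.<-trans (ℕ.n<1+n m) m+1<D

    0<D : 0 ℕ.< D
    0<D = ℕ.<-trans ℕ.z<s m+1<D

    θ≈-K : θ ≈ - K
    θ≈-K = linear-combination
      (solve 3 (λ k s θ → θ :- :- k := (:- con (+ 1)) :* (k :* s :- θ) :+ k :* (s :- :- con (+ 1))) refl K (σ 1) θ)
      (_ · Kσ₁≈θ 0<D σ-cos ⊞ K · σ₁≈-1)

    η≈-θ′ : η ≈ - θ′
    η≈-θ′ = linear-combination
      (solve 5 (λ k s r θ′ η → η :- :- θ′ :=
          (:- con (+ 1)) :* (k :* (s :* r) :- η) :+ (:- con (+ 1)) :* (k :* r :- θ′)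
          :+ (k :* r) :* (s :- :- con (+ 1)))
        refl K (σ 1) (ρ 1) θ′ η)
      (_ · Kσ₁≈θ 0<D τ-cos ⊞ _ · Kσ₁≈θ 0<D ρ-cos ⊞ _ · σ₁≈-1)

    Bσ-alternates : ∀ {j} → suc j ℕ.≤ m → σ (suc j) ≈ - σ j → B (suc j) * σ (2 ℕ.+ j) ≈ B (suc j) * (- σ (suc j))
    Bσ-alternates {j} j+1≤m σⱼ₊₁≈-σⱼ = linear-combination
      (solve 8 (λ c a b k θ w z y → b :* y :- b :* (:- z) :=
          con (+ 1) :* (c :* w :+ (a :* z :+ b :* y) :- θ :* z) :+ (:- c) :* (z :- :- w)
          :+ (:- z) :* (k :- (c :+ a :+ b)) :+ (:- (z :+ z)) :* (a :- con (+ 0)) :+ z :* (θ :- :- k))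
        refl (C (suc j)) (A (suc j)) (B (suc j)) K θ (σ j) (σ (suc j)) (σ (2 ℕ.+ j)))
      (1# · recurrence σ-cos j+1<D ⊞ _ · σⱼ₊₁≈-σⱼ ⊞ _ · K≈C+A+B j+1<D ⊞ _ · A≈0 (a≡0 j+1≤m) ⊞ _ · θ≈-K)
      where
      j+1<D : suc j ℕ.< D
      j+1<D = ℕ.≤-<-trans j+1≤m m<D

    alternating : ∀ {j} → j ℕ.≤ m → σ (suc j) ≈ - σ j
    alternating {zero}  _      = trans σ₁≈-1 (-‿cong (sym (proj₁ σ-cos)))
    alternating {suc j} j+1≤m  = *-cancelˡ (B≉0 (ℕ.≤-<-trans j+1≤m m<D))
      (Bσ-alternates j+1≤m (alternating (ℕ.<⇒≤ j+1≤m)))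

    σ²≈1 : ∀ {j} → j ℕ.≤ suc m → σ j * σ j ≈ 1#
    σ²≈1 {zero}  _         = trans (*-cong (proj₁ σ-cos) (proj₁ σ-cos)) (*-identityˡ 1#)
    σ²≈1 {suc j} j+1≤m+1   = begin
      σ (suc j) * σ (suc j)   ≈⟨ *-cong (alternating (ℕ.≤-pred j+1≤m+1)) (alternating (ℕ.≤-pred j+1≤m+1)) ⟩
      (- σ j) * (- σ j)       ≈⟨ solve 1 (λ s → (:- s) :* (:- s) := s :* s) refl (σ j) ⟩
      σ j * σ j               ≈⟨ σ²≈1 (ℕ.<⇒≤ j+1≤m+1) ⟩
      1#                      ∎

    Bσₘ₊₂ : B (suc m) * σ (2 ℕ.+ m) ≈ - ((B (suc m) + A (suc m) + A (suc m)) * σ (suc m))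
    Bσₘ₊₂ = linear-combination
      (solve 8 (λ c a b k θ w z y → b :* y :- :- ((b :+ a :+ a) :* z) :=
          con (+ 1) :* (c :* w :+ (a :* z :+ b :* y) :- θ :* z) :+ (:- c) :* (z :- :- w)
          :+ (:- z) :* (k :- (c :+ a :+ b)) :+ z :* (θ :- :- k))
        refl (C (suc m)) (A (suc m)) (B (suc m)) K θ (σ m) (σ (suc m)) (σ (2 ℕ.+ m)))
      (1# · recurrence σ-cos m+1<D ⊞ _ · alternating ℕ.≤-refl ⊞ _ · K≈C+A+B m+1<D ⊞ _ · θ≈-K)

    -- The ρ-recurrence at m + 1 plus σₘ₊₁ times the στ-recurrence at m + 1.
    2A·ρₘ₊₁≈2A·ρₘ₊₂ : (A (suc m) + A (suc m)) * ρ (suc m) ≈ (A (suc m) + A (suc m)) * ρ (2 ℕ.+ m)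
    2A·ρₘ₊₁≈2A·ρₘ₊₂ = linear-combination
      (solve 11 (λ c a b θ′ η e e₋ x ρ₋ ρ₀ ρ₊ →
          let eτ = :- c :* ρ₋ :+ a :* ρ₀ :- (b :+ a :+ a) :* ρ₊ :+ θ′ :* ρ₀
          in (a :+ a) :* ρ₀ :- (a :+ a) :* ρ₊ :=
          (:- eτ) :* (e :* e :- con (+ 1))
          :+ (:- (c :* e :* ρ₋)) :* (e :- :- e₋)
          :+ (:- (e :* ρ₊)) :* (b :* x :- :- ((b :+ a :+ a) :* e))
          :+ con (+ 1) :* (c :* ρ₋ :+ (a :* ρ₀ :+ b :* ρ₊) :- θ′ :* ρ₀)
          :+ e :* (c :* (e₋ :* ρ₋) :+ (a :* (e :* ρ₀) :+ b :* (x :* ρ₊)) :- η :* (e :* ρ₀))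
          :+ (e :* e :* ρ₀) :* (η :- :- θ′))
        refl (C (suc m)) (A (suc m)) (B (suc m)) θ′ η (σ (suc m)) (σ m) (σ (2 ℕ.+ m)) (ρ m) (ρ (suc m)) (ρ (2 ℕ.+ m)))
      (_ · σ²≈1 ℕ.≤-refl ⊞ _ · alternating ℕ.≤-refl ⊞ _ · Bσₘ₊₂ ⊞ 1# · recurrence ρ-cos m+1<D
       ⊞ _ · recurrence τ-cos m+1<D ⊞ _ · η≈-θ′)

    ρₘ₊₁≈ρₘ₊₂ : ρ (suc m) ≈ ρ (2 ℕ.+ m)
    ρₘ₊₁≈ρₘ₊₂ = *-cancelˡ 2A≉0 2A·ρₘ₊₁≈2A·ρₘ₊₂
      where
      2A≉0 : A (suc m) + A (suc m) ≉ 0#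
      2A≉0 = n>0⇒fromℕ≉0 (ℕ.<-≤-trans aₘ₊₁>0 (ℕ.m≤m+n _ _)) ∘ trans (fromℕ-+ (a (suc m)) (a (suc m)))

    ρₘ₊₂≉0 : ρ (2 ℕ.+ m) ≉ 0#
    ρₘ₊₂≉0 ρₘ₊₂≈0 = no-consecutive-zeros ρ-cos m+1<D (trans ρₘ₊₁≈ρₘ₊₂ ρₘ₊₂≈0) ρₘ₊₂≈0

    Q : Carrier
    Q = C (2 ℕ.+ m) * A (suc m) + A (2 ℕ.+ m) * (B (suc m) + A (suc m) + A (suc m))

    Q≉0 : Q ≉ 0#
    Q≉0 Q≈0 = n>0⇒fromℕ≉0 q>0 (trans fromℕq≈Q Q≈0)
      where
      q : ℕ
      q = c (2 ℕ.+ m) ℕ.* a (suc m) ℕ.+ a (2 ℕ.+ m) ℕ.* (b (suc m) ℕ.+ a (suc m) ℕ.+ a (suc m))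
      q>0 : 0 ℕ.< q
      q>0 = ℕ.<-≤-trans (ℕ.*-mono-≤ (c>0 m+1<D) aₘ₊₁>0) (ℕ.m≤m+n _ _)
      fromℕq≈Q : fromℕ q ≈ Q
      fromℕq≈Q = trans (fromℕ-+ (c (2 ℕ.+ m) ℕ.* a (suc m)) _) (+-cong (fromℕ-* (c (2 ℕ.+ m)) (a (suc m)))
        (trans (fromℕ-* (a (2 ℕ.+ m)) _) (*-congˡ (trans (fromℕ-+ (b (suc m) ℕ.+ a (suc m)) (a (suc m)))
          (+-congʳ (fromℕ-+ (b (suc m)) (a (suc m))))))))

    -- b times the στ-recurrence at m + 2, with bσₘ₊₃ and bρₘ₊₃ eliminated by the σ- and
    -- ρ-recurrences, leaves (θ′ − k) ρₘ₊₂ ((c + 2a) σₘ₊₂ + c σₘ₊₁) ≈ 0; multiplying by bₘ₊₁ σₘ₊₁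
    -- and using Bσₘ₊₂ turns the last factor into 2Q.
    2Qρθ′≈2QρK : fromℕ 2 * Q * ρ (2 ℕ.+ m) * θ′ ≈ fromℕ 2 * Q * ρ (2 ℕ.+ m) * K
    2Qρθ′≈2QρK = linear-combination
      (solve 15 (λ c a b k θ θ′ η e x y r r′ u a₀ b₀ →
          let q  = c :* a₀ :+ a :* (b₀ :+ a₀ :+ a₀)
              by = :- (c :* e :+ a :* x :+ k :* x)
          in con (+ 2) :* q :* r′ :* θ′ :- con (+ 2) :* q :* r′ :* k :=
          (e :* b₀ :* b) :* (c :* (e :* r) :+ (a :* (x :* r′) :+ b :* (y :* u)) :- η :* (x :* r′))
          :+ (:- (e :* b₀ :* b :* u)) :* (c :* e :+ (a :* x :+ b :* y) :- θ :* x)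
          :+ (:- (e :* b₀ :* by)) :* (c :* r :+ (a :* r′ :+ b :* u) :- θ′ :* r′)
          :+ (:- (e :* b₀ :* (b :* c :* e :- c :* by))) :* (r :- r′)
          :+ (:- (e :* b₀ :* r′ :* x :* (c :+ a :- θ′)) :- con (+ 2) :* q :* r′) :* (k :- (c :+ a :+ b))
          :+ (e :* r′ :* (θ′ :- (c :+ a :+ b)) :* (c :+ a :+ a)) :* (b₀ :* x :- :- ((b₀ :+ a₀ :+ a₀) :* e))
          :+ (:- (con (+ 2) :* q :* r′ :* (θ′ :- (c :+ a :+ b)))) :* (e :* e :- con (+ 1))
          :+ (:- (e :* b₀ :* b :* u :* x)) :* (θ :- :- k)
          :+ (e :* b₀ :* b :* x :* r′) :* (η :- :- θ′))
        refl (C (2 ℕ.+ m)) (A (2 ℕ.+ m)) (B (2 ℕ.+ m)) K θ θ′ η (σ (suc m)) (σ (2 ℕ.+ m)) (σ (3 ℕ.+ m))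
             (ρ (suc m)) (ρ (2 ℕ.+ m)) (ρ (3 ℕ.+ m)) (A (suc m)) (B (suc m)))
      (_ · recurrence τ-cos m+2<D ⊞ _ · recurrence σ-cos m+2<D ⊞ _ · recurrence ρ-cos m+2<D ⊞ _ · ρₘ₊₁≈ρₘ₊₂
       ⊞ _ · K≈C+A+B m+2<D ⊞ _ · Bσₘ₊₂ ⊞ _ · σ²≈1 ℕ.≤-refl ⊞ _ · θ≈-K ⊞ _ · η≈-θ′)

    θ′≈K : θ′ ≈ K
    θ′≈K = *-cancelˡ (*-≉0 (*-≉0 (fromℕ-suc≉0 1) Q≉0) ρₘ₊₂≉0) 2Qρθ′≈2QρK

  σ₁≈1⇒θ≈K : ∀ {θ σ} → 0 ℕ.< D → IsPseudoCosine θ σ → σ 1 ≈ 1# → θ ≈ K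
  σ₁≈1⇒θ≈K {θ} {σ} 0<D σ-cos σ₁≈1 = begin
    θ         ≈⟨ Kσ₁≈θ 0<D σ-cos ⟨
    K * σ 1   ≈⟨ *-congˡ σ₁≈1 ⟩
    K * 1#    ≈⟨ *-identityʳ K ⟩
    K         ∎

  first-positive-a : ∀ {i} → 0 ℕ.< a i →
    ∃[ m ] (suc m ℕ.≤ i × (∀ {j} → j ℕ.≤ m → a j ≡ 0) × 0 ℕ.< a (suc m))
  first-positive-a aᵢ>0 with least-witness (λ j → 0 ℕ.<? a j) aᵢ>0
  ... | zero  , _      , a₀>0   , _     = contradiction a₀≡0 (ℕ.>⇒≢ a₀>0)
  ... | suc m , m+1≤i , aₘ₊₁>0 , below = m , m+1≤i , (λ j≤m → ℕ.n≤0⇒n≡0 (ℕ.≮⇒≥ (below (ℕ.s≤s j≤m)))) , aₘ₊₁>0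

  module _ (a₁≡0 : a 1 ≡ 0) {i : ℕ} (i+2≤D : i ℕ.+ 2 ℕ.≤ D) (aᵢ≢0 : a i ≢ 0) where

    1<D : 1 ℕ.< D
    1<D = ℕ.≤-trans (ℕ.m≤n+m 2 i) i+2≤D

    0<D : 0 ℕ.< D
    0<D = ℕ.<-trans ℕ.z<s 1<D

    σ₁²≈1⇒θ≈K⊎θ′≈K : ∀ {θ θ′} → ((σ , _) : TightPair θ θ′) → σ 1 * σ 1 ≈ 1# → θ ≈ K ⊎ θ′ ≈ K
    σ₁²≈1⇒θ≈K⊎θ′≈K (σ , ρ , σ-cos , ρ-cos , η , τ-cos) σ₁²≈1 with x*x≈1⇒x≈±1 σ₁²≈1
    ... | inj₁ σ₁≈1  = inj₁ (σ₁≈1⇒θ≈K 0<D σ-cos σ₁≈1)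
    ... | inj₂ σ₁≈-1 with first-positive-a (ℕ.n≢0⇒n>0 aᵢ≢0)
    ...   | m , m+1≤i , a≡0 , aₘ₊₁>0 =
            inj₂ (Alternating.θ′≈K a≡0 aₘ₊₁>0 m+2<D σ-cos ρ-cos τ-cos σ₁≈-1)
      where
      m+2<D : 2 ℕ.+ m ℕ.< D
      m+2<D = ℕ.≤-trans (ℕ.≤-reflexive (ℕ.+-comm 2 (suc m))) (ℕ.≤-trans (ℕ.+-monoˡ-≤ 2 m+1≤i) i+2≤D)

    tight⇒θ≈K⊎θ′≈K : ∀ {θ θ′} → TightPair θ θ′ → θ ≈ K ⊎ θ′ ≈ K
    tight⇒θ≈K⊎θ′≈K tight@(σ , ρ , σ-cos , ρ-cos , στ-cos) =
      Sum.[ σ₁²≈1⇒θ≈K⊎θ′≈K tight , Sum.swap ∘ σ₁²≈1⇒θ≈K⊎θ′≈K (tightPair-sym tight) ]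
        (tight⇒σ₁²≈1⊎ρ₁²≈1 a₁≡0 1<D σ-cos ρ-cos στ-cos)

open import Data.Nat using (ℕ; _≤_; _+_)

theorem10p1 : (ℝ : RealField) (Γ : Graph) (D : ℕ) (p : ℕ → ℕ → ℕ → ℕ) →
    DistanceRegular Γ D p → 4 ≤ D →
    Intersection.a p D 1 ≡ 0 →
    Σ ℕ (λ i → 2 ≤ i × i + 2 ≤ D × Intersection.a p D i ≢ 0) →
    ((θ : RealField.Carrier ℝ) →
       Tight.TightPair ℝ p D θ (RealField.fromℕ ℝ (Intersection.k p D))) ×
    ((θ θ' : RealField.Carrier ℝ) → Tight.TightPair ℝ p D θ θ' →
       RealField._≈_ ℝ θ (RealField.fromℕ ℝ (Intersection.k p D)) ⊎
       RealField._≈_ ℝ θ' (RealField.fromℕ ℝ (Intersection.k p D)))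
-- The hypothesis 2 ≤ i is implied by a₀ = a₁ = 0.
theorem10p1 ℝ Γ D p drg 4≤D a₁≡0 (i , _ , i+2≤D , aᵢ≢0) =
  tightPair-K , λ θ θ′ → tight⇒θ≈K⊎θ′≈K a₁≡0 i+2≤D aᵢ≢0
  where
  open PseudoCosines ℝ (GraphDistance.distanceRegular⇒intersectionLaws Γ {D} {p} drg (ℕ.<-≤-trans ℕ.z<s 4≤D))
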